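{- Let $a_{ij}$ ($i,j\ge1$, $|i-j|\le1$) be non-commuting indeterminates, and set $a_{ij}=0$ when $|i-j|>1$. Give each diagonal variable $a_{ii}$ degree $2$ and each off-diagonal variable $a_{i,i\pm1}$ degree $1$. Let $$F=1+\sum a_{i_0i_1}a_{i_1i_2}\cdots a_{i_{m-1}i_m},$$ the sum over all $m\ge1$ and all sequences $(i_0,\dots,i_m)$ of positive integers with $i_0=i_m=1$ and $|i_r-i_{r+1}|\le1$ for all $r$, and write $F=1+\sum_{n\ge1}t_n$ with $t_n$ homogeneous of degree $2n$. Set $a_{11}=0$. Then for each $n\ge1$ the number of monomials in $t_n$ is the $n$-th little Schröder number $s_n$.
   Context: $F$ is the inverse $|T|_{11}^{ -1}$ of the $(1,1)$ quasideterminant of $T=I-A$, where $A=(a_{ij})$ is the infinite Jacobi matrix. The little Schröder numbers (OEIS A001003) are $s_0=1$, $s_1=1$, $s_2=3$, $s_3=11$, $s_4=45,\dots$; for $n\ge1$, $s_n=r_n/2$ where $r_n$ is the $n$-th large Schröder number (the number of lattice paths from $(0,0)$ to $(n,n)$ with steps $(1,0),(0,1),(1,1)$ never going above the diagonal). -}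

module Defs where

open import Data.Nat using (ℕ; zero; suc; _+_; _*_; _≤_; _≤ᵇ_; _≡ᵇ_; _/_)
open import Data.Bool using (if_then_else_)
open import Data.Product using (_×_; _,_; ∃-syntax)
open import Data.List using (List; []; _∷_; _++_; map)
open import Data.Nat.ListAction using (sum)
open import Data.List.Relation.Unary.All using (All)
open import Data.List.Membership.Propositional using (_∉_)
open import Relation.Binary.PropositionalEquality using (_≡_)

-- lp x y = number of lattice paths from (0,0) to (x,y) with steps
-- (1,0), (0,1), (1,1) that never go above the diagonal (all visited
-- points (a,b) satisfy b ≤ a).
lp : ℕ → ℕ → ℕ
lp zero    zero    = 1
lp zero    (suc y) = 0
lp (suc x) zero    = 1
lp (suc x) (suc y) =
  if y ≤ᵇ x then lp x (suc y) + lp (suc x) y + lp x y else 0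

largeSchröder : ℕ → ℕ
largeSchröder n = lp n n

littleSchröder : ℕ → ℕ
littleSchröder zero    = 1
littleSchröder (suc n) = largeSchröder (suc n) / 2

-- the variable a_ij is represented by the pair (i , j);
-- a (non-commutative) monomial is a word in these variables
Var : Set
Var = ℕ × ℕ

Word : Set
Word = List Var

Adj : Var → Set
Adj (i , j) = (i ≤ suc j) × (j ≤ suc i)

varDeg : Var → ℕ
varDeg (i , j) = if i ≡ᵇ j then 2 else 1

wordDeg : Word → ℕ
wordDeg w = sum (map varDeg w)

edges : List ℕ → Word
edges (i ∷ j ∷ rest) = (i , j) ∷ edges (j ∷ rest)
edges _              = []

closedSeq : List ℕ → List ℕ
closedSeq mid = 1 ∷ (mid ++ (1 ∷ []))

-- w is a monomial (with nonzero coefficient) of t_n after setting a_11 = 0: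
-- w is the word of an admissible index sequence (positive entries,
-- i_0 = i_m = 1, consecutive entries differ by ≤ 1), of degree 2n,
-- not containing the variable a_11.
IsMonomialOf-t : ℕ → Word → Set
IsMonomialOf-t n w =
  ∃[ mid ] ( All (1 ≤_) mid
           × All Adj (edges (closedSeq mid))
           × edges (closedSeq mid) ≡ w
           × wordDeg w ≡ 2 * n
           × (1 , 1) ∉ w )

module Submission where

-- After setting a₁₁ = 0, a monomial of t_n is the word
-- a_{1 i₁} a_{i₁ i₂} ⋯ a_{i_{m-1} 1} of a walk on the positive integers
-- from 1 back to 1 whose steps are up (+1), down (−1) or level (0), with
-- no level step at 1, of degree 2n (up/down steps weigh 1, level steps 2).
-- A walk that still has to descend from vertex h+1 to 1 has remaining
-- degree 2y + h for some y ≥ 0, and its first step is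
--   down  (h ↦ h−1, y ↦ y),  up  (h ↦ h+1, y ↦ y−1),  level  (h ↦ h, y ↦ y−1).

open import Defs
open import Data.Nat using (ℕ; zero; suc; _+_; _*_; _≤_; _≤ᵇ_; _/_; s≤s; z≤n)
open import Data.Nat.Properties
  using (≤-refl; ≤-trans; n≤1+n; m≤n+m; 1+n≰n; ≤-antisym; <-cmp; +-suc; +-assoc;
         +-identityʳ; *-comm; *-cancelˡ-≡; ≤⇒≤ᵇ; ≤ᵇ⇒≤)
open import Data.Nat.DivMod using (m*n/n≡m)
open import Data.Nat.Tactic.RingSolver using (solve-∀)
open import Data.Bool using (true; false)
open import Data.Bool.Properties using (T-≡)
open import Data.Product using (_×_; _,_; proj₁; ∃-syntax)
open import Data.Product.Properties using (,-injectiveʳ)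
open import Data.Sum using (_⊎_; inj₁; inj₂; [_,_]′)
open import Function using (_∘_)
open import Data.Empty using (⊥-elim)
open import Data.List using (List; []; _∷_; _++_; map; length)
open import Data.List.Properties using (∷-injective; ∷-injectiveʳ; length-map; length-++)
open import Data.List.Relation.Unary.All using (All; []; _∷_)
import Data.List.Relation.Unary.All.Properties as All
open import Data.List.Relation.Unary.Any using (here; there)
open import Data.List.Membership.Propositional using (_∈_; _∉_)
open import Data.List.Membership.Propositional.Properties
  using (∈-map⁺; ∈-map⁻; ∈-++⁺ˡ; ∈-++⁺ʳ; ∈-++⁻)
open import Data.List.Relation.Unary.Unique.Propositional using (Unique)
import Data.List.Relation.Unary.Unique.Propositional.Properties as Unique
import Data.List.Relation.Unary.AllPairs as AllPairs
open import Data.List.Relation.Binary.Disjoint.Propositional using (Disjoint)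
open import Function.Bundles using (_⇔_; mk⇔; Equivalence)
open import Relation.Binary.Definitions using (tri<; tri≈; tri>)
open import Relation.Binary.PropositionalEquality
  using (_≡_; _≢_; refl; sym; trans; cong; cong₂; subst; module ≡-Reasoning)

-- Walk h y s: s is the rest of a walk standing at vertex h+1, ending at
-- vertex 1, with remaining degree 2y + h and no level step at vertex 1.
data Walk : ℕ → ℕ → List ℕ → Set where
  stop  : Walk 0 0 []
  down  : ∀ {h y s} → Walk h y s → Walk (suc h) y (suc h ∷ s)
  up    : ∀ {h y s} → Walk (suc h) y s → Walk h (suc y) (suc (suc h) ∷ s)
  level : ∀ {h y s} → Walk (suc h) y s → Walk (suc h) (suc y) (suc (suc h) ∷ s)

walks : ℕ → ℕ → List (List ℕ)
walks zero    zero    = [] ∷ []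
walks zero    (suc h) = map (suc h ∷_) (walks zero h)
walks (suc y) zero    = map (2 ∷_) (walks y 1)
walks (suc y) (suc h) =
  map (suc h ∷_) (walks (suc y) h) ++
  map (suc (suc (suc h)) ∷_) (walks y (suc (suc h))) ++
  map (suc (suc h) ∷_) (walks y (suc h))

walkCount : ℕ → ℕ → ℕ
walkCount zero    h       = 1
walkCount (suc y) zero    = walkCount y 1
walkCount (suc y) (suc h) =
  walkCount (suc y) h + walkCount y (suc (suc h)) + walkCount y (suc h)

walk⇒∈walks : ∀ {h y s} → Walk h y s → s ∈ walks y h
walk⇒∈walks stop                  = here refl
walk⇒∈walks (down {y = zero} w)   = ∈-map⁺ _ (walk⇒∈walks w)
walk⇒∈walks (down {y = suc y} w)  = ∈-++⁺ˡ (∈-map⁺ _ (walk⇒∈walks w))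
walk⇒∈walks (up {h = zero} w)     = ∈-map⁺ _ (walk⇒∈walks w)
walk⇒∈walks (up {h = suc h} {y} w) =
  ∈-++⁺ʳ (map (suc h ∷_) (walks (suc y) h)) (∈-++⁺ˡ (∈-map⁺ _ (walk⇒∈walks w)))
walk⇒∈walks (level {h} {y} w)       =
  ∈-++⁺ʳ (map (suc h ∷_) (walks (suc y) h))
    (∈-++⁺ʳ (map (suc (suc (suc h)) ∷_) (walks y (suc (suc h)))) (∈-map⁺ _ (walk⇒∈walks w)))

prefixed-elim : ∀ {a : ℕ} {xs} (P : List ℕ → Set) →
                (∀ {t} → t ∈ xs → P (a ∷ t)) → ∀ {s} → s ∈ map (a ∷_) xs → P s
prefixed-elim P f s∈ with ∈-map⁻ _ s∈
... | _ , t∈ , refl = f t∈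

∈walks⇒walk : ∀ y h {s} → s ∈ walks y h → Walk h y s
∈walks⇒walk zero zero (here refl) = stop
∈walks⇒walk zero (suc h) s∈ =
  prefixed-elim (Walk (suc h) zero) (λ t∈ → down (∈walks⇒walk zero h t∈)) s∈
∈walks⇒walk (suc y) zero s∈ =
  prefixed-elim (Walk zero (suc y)) (λ t∈ → up (∈walks⇒walk y 1 t∈)) s∈
∈walks⇒walk (suc y) (suc h) s∈ =
  [ prefixed-elim W (λ t∈ → down (∈walks⇒walk (suc y) h t∈))
  , [ prefixed-elim W (λ t∈ → up (∈walks⇒walk y (suc (suc h)) t∈))
    , prefixed-elim W (λ t∈ → level (∈walks⇒walk y (suc h) t∈))
    ]′ ∘ ∈-++⁻ (map (suc (suc (suc h)) ∷_) (walks y (suc (suc h))))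
  ]′ (∈-++⁻ (map (suc h ∷_) (walks (suc y) h)) s∈)
  where W = Walk (suc h) (suc y)

prefix-unique : ∀ {a : ℕ} {xs : List (List ℕ)} → Unique xs → Unique (map (a ∷_) xs)
prefix-unique = Unique.map⁺ ∷-injectiveʳ

prefix-disjoint : ∀ {a b : ℕ} → a ≢ b → (xs ys : List (List ℕ)) →
                  Disjoint (map (a ∷_) xs) (map (b ∷_) ys)
prefix-disjoint a≢b xs ys (s∈xs , s∈ys) with ∈-map⁻ _ s∈xs | ∈-map⁻ _ s∈ys
... | _ , _ , refl | _ , _ , eq = a≢b (proj₁ (∷-injective eq))

disjoint-++ʳ : ∀ {xs ys zs : List (List ℕ)} →
               Disjoint xs ys → Disjoint xs zs → Disjoint xs (ys ++ zs)
disjoint-++ʳ {ys = ys} xs#ys xs#zs (s∈xs , s∈yz) with ∈-++⁻ ys s∈yz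
... | inj₁ s∈ys = xs#ys (s∈xs , s∈ys)
... | inj₂ s∈zs = xs#zs (s∈xs , s∈zs)

walks-unique : ∀ y h → Unique (walks y h)
walks-unique zero    zero    = [] AllPairs.∷ AllPairs.[]
walks-unique zero    (suc h) = prefix-unique (walks-unique zero h)
walks-unique (suc y) zero    = prefix-unique (walks-unique y 1)
walks-unique (suc y) (suc h) =
  Unique.++⁺ (prefix-unique (walks-unique (suc y) h))
    (Unique.++⁺ (prefix-unique (walks-unique y (suc (suc h))))
                (prefix-unique (walks-unique y (suc h)))
                (prefix-disjoint (λ ()) _ _))
    (disjoint-++ʳ {ys = map (suc (suc (suc h)) ∷_) (walks y (suc (suc h)))}
                  (prefix-disjoint (λ ()) _ _) (prefix-disjoint (λ ()) _ _))

length-walks : ∀ y h → length (walks y h) ≡ walkCount y h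
length-walks zero    zero    = refl
length-walks zero    (suc h) = trans (length-map _ (walks zero h)) (length-walks zero h)
length-walks (suc y) zero    = trans (length-map _ (walks y 1)) (length-walks y 1)
length-walks (suc y) (suc h) = begin
  length (D ++ U ++ L)             ≡⟨ length-++ D ⟩
  length D + length (U ++ L)       ≡⟨ cong (length D +_) (length-++ U) ⟩
  length D + (length U + length L) ≡⟨ sym (+-assoc (length D) _ _) ⟩
  length D + length U + length L
    ≡⟨ cong₂ _+_ (cong₂ _+_ (prefixed (walks (suc y) h) (length-walks (suc y) h))
                            (prefixed (walks y (suc (suc h))) (length-walks y (suc (suc h)))))
                 (prefixed (walks y (suc h)) (length-walks y (suc h))) ⟩
  walkCount (suc y) (suc h) ∎
  where
  open ≡-Reasoning
  D = map (suc h ∷_) (walks (suc y) h)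
  U = map (suc (suc (suc h)) ∷_) (walks y (suc (suc h)))
  L = map (suc (suc h) ∷_) (walks y (suc h))
  prefixed : ∀ {a : ℕ} {n} (xs : List (List ℕ)) → length xs ≡ n → length (map (a ∷_) xs) ≡ n
  prefixed xs eq = trans (length-map _ xs) eq

-- This is the inductive form of the
-- conditions in IsMonomialOf-t.
data Admissible : ℕ → List ℕ → ℕ → Set where
  end  : Admissible 1 [] 0
  step : ∀ {i j s d} → 1 ≤ j → Adj (i , j) → (i , j) ≢ (1 , 1) →
         Admissible j s d → Admissible i (j ∷ s) (varDeg (i , j) + d)

adjacent : ∀ {i j} → Adj (i , j) → j ≡ suc i ⊎ j ≡ i ⊎ i ≡ suc j
adjacent {i} {j} (i≤1+j , j≤1+i) with <-cmp i j
... | tri< i<j _ _ = inj₁ (≤-antisym j≤1+i i<j)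
... | tri≈ _ i≡j _ = inj₂ (inj₁ (sym i≡j))
... | tri> _ _ j<i = inj₂ (inj₂ (≤-antisym i≤1+j j<i))

adj-up : ∀ i → Adj (i , suc i)
adj-up i = ≤-trans (n≤1+n i) (n≤1+n _) , ≤-refl

adj-level : ∀ i → Adj (i , i)
adj-level i = n≤1+n i , n≤1+n i

adj-down : ∀ i → Adj (suc i , i)
adj-down i = ≤-refl , ≤-trans (n≤1+n i) (n≤1+n _)

varDeg-up : ∀ i → varDeg (i , suc i) ≡ 1
varDeg-up zero    = refl
varDeg-up (suc i) = varDeg-up i

varDeg-level : ∀ i → varDeg (i , i) ≡ 2
varDeg-level zero    = refl
varDeg-level (suc i) = varDeg-level i

varDeg-down : ∀ i → varDeg (suc i , i) ≡ 1
varDeg-down zero    = refl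
varDeg-down (suc i) = varDeg-down i

degree-down : ∀ y h → varDeg (suc (suc h) , suc h) + (2 * y + h) ≡ 2 * y + suc h
degree-down y h rewrite varDeg-down (suc h) = sym (+-suc (2 * y) h)

degree-up : ∀ y h → varDeg (suc h , suc (suc h)) + (2 * y + suc h) ≡ 2 * suc y + h
degree-up y h rewrite varDeg-up (suc h) = shift y h
  where
  shift : ∀ y h → 1 + (2 * y + suc h) ≡ 2 * suc y + h
  shift = solve-∀

degree-level : ∀ y h →
  varDeg (suc (suc h) , suc (suc h)) + (2 * y + suc h) ≡ 2 * suc y + suc h
degree-level y h rewrite varDeg-level (suc (suc h)) = shift y h
  where
  shift : ∀ y h → 2 + (2 * y + suc h) ≡ 2 * suc y + suc h
  shift = solve-∀

step≡ : ∀ {i j s d e} → Adj (i , suc j) → (i , suc j) ≢ (1 , 1) → Admissible (suc j) s d →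
        varDeg (i , suc j) + d ≡ e → Admissible i (suc j ∷ s) e
step≡ adj ne a refl = step (s≤s z≤n) adj ne a

walk⇒admissible : ∀ {h y s} → Walk h y s → Admissible (suc h) s (2 * y + h)
walk⇒admissible stop               = end
walk⇒admissible (down {h} {y} w)   =
  step≡ (adj-down (suc h)) (λ ()) (walk⇒admissible w) (degree-down y h)
walk⇒admissible (up {h} {y} w)     =
  step≡ (adj-up (suc h)) (λ ()) (walk⇒admissible w) (degree-up y h)
walk⇒admissible (level {h} {y} w)  =
  step≡ (adj-level (suc (suc h))) (λ ()) (walk⇒admissible w) (degree-level y h)

admissible⇒walk : ∀ {h s d} → Admissible (suc h) s d → ∃[ y ] (d ≡ 2 * y + h × Walk h y s)
admissible⇒walk end = 0 , refl , stop
admissible⇒walk {h} (step {j = suc k} _ adj ne a) with admissible⇒walk a | adjacent adj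
... | y , refl , w | inj₁ refl        = suc y , degree-up y h , up w
... | y , refl , w | inj₂ (inj₂ refl) = y , degree-down y k , down w
admissible⇒walk {zero} (step _ _ ne _) | _ , refl , _ | inj₂ (inj₁ refl) = ⊥-elim (ne refl)
admissible⇒walk {suc h} (step _ _ _ _) | y , refl , w | inj₂ (inj₁ refl) =
  suc y , degree-level y h , level w

word : List ℕ → Word
word s = edges (1 ∷ s)

edges-injective : ∀ {i} {s t : List ℕ} → edges (i ∷ s) ≡ edges (i ∷ t) → s ≡ t
edges-injective {s = []}    {[]}    _  = refl
edges-injective {s = j ∷ s} {k ∷ t} eq with ∷-injective eq
... | first , rest with ,-injectiveʳ first
...   | refl = cong (j ∷_) (edges-injective rest)

admissible-conditions : ∀ {i s d} → Admissible i s d →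
  All (1 ≤_) s × All Adj (edges (i ∷ s)) × (1 , 1) ∉ edges (i ∷ s) ×
  wordDeg (edges (i ∷ s)) ≡ d
admissible-conditions end = [] , [] , (λ ()) , refl
admissible-conditions {i} (step {j = j} pos adj ne a)
  with admissible-conditions a
... | poss , adjs , no11 , deg = pos ∷ poss , adj ∷ adjs , no11′ , cong (varDeg (i , j) +_) deg
  where
  no11′ : (1 , 1) ∉ (i , j) ∷ edges (j ∷ _)
  no11′ (here eq) = ne (sym eq)
  no11′ (there e) = no11 e

split-last : ∀ {i s d} → Admissible i s d → (s ≡ [] × d ≡ 0) ⊎ ∃[ mid ] s ≡ mid ++ 1 ∷ []
split-last end = inj₁ (refl , refl)
split-last (step _ _ _ end) = inj₂ ([] , refl)
split-last (step {j = j} _ _ _ a@(step _ _ _ _)) with split-last a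
... | inj₁ (() , _)
... | inj₂ (mid , eq) = inj₂ (j ∷ mid , cong (j ∷_) eq)

conditions⇒admissible : ∀ i mid → All (1 ≤_) mid →
  All Adj (edges (i ∷ mid ++ 1 ∷ [])) → (1 , 1) ∉ edges (i ∷ mid ++ 1 ∷ []) →
  Admissible i (mid ++ 1 ∷ []) (wordDeg (edges (i ∷ mid ++ 1 ∷ [])))
conditions⇒admissible i [] [] (adj ∷ []) no11 =
  step (s≤s z≤n) adj (λ eq → no11 (here (sym eq))) end
conditions⇒admissible i (j ∷ mid) (pos ∷ poss) (adj ∷ adjs) no11 =
  step pos adj (λ eq → no11 (here (sym eq)))
       (conditions⇒admissible j mid poss adjs (λ e → no11 (there e)))

admissible⇒monomial : ∀ {m s} → Admissible 1 s (2 * suc m) → IsMonomialOf-t (suc m) (word s)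
admissible⇒monomial a with split-last a | admissible-conditions a
... | inj₁ (_ , ())     | _
... | inj₂ (mid , refl) | poss , adjs , no11 , deg =
  mid , All.++⁻ˡ mid poss , adjs , refl , deg , no11

monomial⇔walk : ∀ m w → IsMonomialOf-t (suc m) w ⇔ (∃[ s ] (Walk 0 (suc m) s × w ≡ word s))
monomial⇔walk m w = mk⇔ to from
  where
  n = suc m
  to : IsMonomialOf-t n w → ∃[ s ] (Walk 0 n s × w ≡ word s)
  to (mid , poss , adjs , refl , deg , no11)
    with admissible⇒walk (subst (Admissible 1 (mid ++ 1 ∷ [])) deg
                            (conditions⇒admissible 1 mid poss adjs no11))
  ... | y , 2n≡2y , walk
    rewrite *-cancelˡ-≡ y n 2 (sym (trans 2n≡2y (+-identityʳ (2 * y))))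
    = mid ++ 1 ∷ [] , walk , refl
  from : ∃[ s ] (Walk 0 n s × w ≡ word s) → IsMonomialOf-t n w
  from (s , walk , refl) =
    admissible⇒monomial (subst (Admissible 1 s) (+-identityʳ (2 * n)) (walk⇒admissible walk))

lp-zero-height : ∀ x → lp x 0 ≡ 1
lp-zero-height zero    = refl
lp-zero-height (suc x) = refl

lp-above-diagonal : ∀ y → lp y (suc y) ≡ 0
lp-above-diagonal zero = refl
lp-above-diagonal (suc y) with suc y ≤ᵇ y in eq
... | false = refl
... | true  = ⊥-elim (1+n≰n (≤ᵇ⇒≤ (suc y) y (Equivalence.from T-≡ eq)))

lp-step : ∀ x y → y ≤ x → lp (suc x) (suc y) ≡ lp x (suc y) + lp (suc x) y + lp x y
lp-step x y y≤x rewrite Equivalence.to T-≡ (≤⇒≤ᵇ y≤x) = refl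

-- pathCount y h = lp (h + y) y, the number of lattice paths ending at
-- distance h right of the diagonal, by a recursion matching walkCount.
pathCount : ℕ → ℕ → ℕ
pathCount zero    h       = 1
pathCount (suc y) zero    = pathCount y 1 + pathCount y 0
pathCount (suc y) (suc h) = pathCount (suc y) h + pathCount y (suc (suc h)) + pathCount y (suc h)

lp≡pathCount : ∀ y h → lp (h + y) y ≡ pathCount y h
lp≡pathCount zero h = trans (cong (λ x → lp x 0) (+-identityʳ h)) (lp-zero-height h)
lp≡pathCount (suc y) zero =
  trans (lp-step y y ≤-refl)
        (cong₂ _+_ (cong₂ _+_ (lp-above-diagonal y) (lp≡pathCount y 1)) (lp≡pathCount y 0))
lp≡pathCount (suc y) (suc h) = begin
  lp (suc h + suc y) (suc y)
    ≡⟨ cong (λ x → lp (suc x) (suc y)) (+-suc h y) ⟩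
  lp (suc (suc (h + y))) (suc y)
    ≡⟨ lp-step (suc (h + y)) y (≤-trans (m≤n+m y h) (n≤1+n _)) ⟩
  lp (suc (h + y)) (suc y) + lp (suc (suc h) + y) y + lp (suc h + y) y
    ≡⟨ cong₂ _+_ (cong₂ _+_ (trans (cong (λ x → lp x (suc y)) (sym (+-suc h y)))
                                   (lp≡pathCount (suc y) h))
                            (lp≡pathCount y (suc (suc h))))
                 (lp≡pathCount y (suc h)) ⟩
  pathCount (suc y) (suc h) ∎
  where open ≡-Reasoning

-- The correction term in  pathCount y h + defect y h = 2 · walkCount y h.
defect : ℕ → ℕ → ℕ
defect y       (suc h) = pathCount y h
defect zero    zero    = 1
defect (suc y) zero    = 0

pathCount-unfold : ∀ y h → pathCount (suc y) h ≡ defect (suc y) h + pathCount y (suc h) + pathCount y h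
pathCount-unfold y zero    = refl
pathCount-unfold y (suc h) = refl

pathCount+defect : ∀ y h → pathCount y h + defect y h ≡ 2 * walkCount y h
pathCount+defect zero    zero    = refl
pathCount+defect zero    (suc h) = refl
pathCount+defect (suc y) zero    = trans (+-identityʳ _) (pathCount+defect y 1)
pathCount+defect (suc y) (suc h) = begin
  (A + B + C) + A
    ≡⟨ cong ((A + B + C) +_) (pathCount-unfold y h) ⟩
  (A + B + C) + (e + C + D)
    ≡⟨ regroup A B C D e ⟩
  (A + e) + (B + C) + (C + D)
    ≡⟨ cong₂ _+_ (cong₂ _+_ (pathCount+defect (suc y) h) (pathCount+defect y (suc (suc h))))
                 (pathCount+defect y (suc h)) ⟩
  2 * walkCount (suc y) h + 2 * walkCount y (suc (suc h)) + 2 * walkCount y (suc h)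
    ≡⟨ double-sum (walkCount (suc y) h) (walkCount y (suc (suc h))) (walkCount y (suc h)) ⟩
  2 * walkCount (suc y) (suc h) ∎
  where
  open ≡-Reasoning
  A = pathCount (suc y) h
  B = pathCount y (suc (suc h))
  C = pathCount y (suc h)
  D = pathCount y h
  e = defect (suc y) h
  regroup : ∀ A B C D e → A + B + C + (e + C + D) ≡ (A + e) + (B + C) + (C + D)
  regroup = solve-∀
  double-sum : ∀ a b c → 2 * a + 2 * b + 2 * c ≡ 2 * (a + b + c)
  double-sum = solve-∀

walkCount≡littleSchröder : ∀ m → walkCount (suc m) 0 ≡ littleSchröder (suc m)
walkCount≡littleSchröder m = sym (begin
  lp n n / 2              ≡⟨ cong (_/ 2) (lp≡pathCount n 0) ⟩
  pathCount n 0 / 2       ≡⟨ cong (_/ 2) (sym (+-identityʳ (pathCount n 0))) ⟩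
  (pathCount n 0 + 0) / 2 ≡⟨ cong (_/ 2) (trans (pathCount+defect n 0) (*-comm 2 (walkCount n 0))) ⟩
  walkCount n 0 * 2 / 2   ≡⟨ m*n/n≡m (walkCount n 0) 2 ⟩
  walkCount n 0           ∎)
  where
  open ≡-Reasoning
  n = suc m

proposition9 : (n : ℕ) → 1 ≤ n →
    ∃[ ws ] ( Unique ws
            × ((w : Word) → (w ∈ ws) ⇔ IsMonomialOf-t n w)
            × length ws ≡ littleSchröder n )
proposition9 (suc m) (s≤s z≤n) =
  map word (walks n 0) ,
  Unique.map⁺ edges-injective (walks-unique n 0) ,
  (λ w → mk⇔ (to w) (from w)) ,
  trans (length-map word (walks n 0))
        (trans (length-walks n 0) (walkCount≡littleSchröder m))
  where
  n = suc m
  to : ∀ w → w ∈ map word (walks n 0) → IsMonomialOf-t n w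
  to w w∈ with ∈-map⁻ word w∈
  ... | s , s∈ , w≡ = Equivalence.from (monomial⇔walk m w) (s , ∈walks⇒walk n 0 s∈ , w≡)
  from : ∀ w → IsMonomialOf-t n w → w ∈ map word (walks n 0)
  from w mono with Equivalence.to (monomial⇔walk m w) mono
  ... | s , walk , refl = ∈-map⁺ word (walk⇒∈walks walk)
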